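{- Let $N\in\mathbb{N}$. For $a, b, c\neq q^{ -n}$, $1\leq n\leq N-1$, and $c\neq q^{ -N}$, \begin{align*} \sum_{n=1}^{N}\genfrac{[}{]}{0pt}{}{N}{n}\frac{(\frac{b}{a})_{n}(q)_{n}(a)_{N-n}a^{n}}{(1-cq^{n})(b)_n(a)_N}= \sum_{n=1}^{N}\genfrac{[}{]}{0pt}{}{N}{n}\frac{(\frac{b}{c})_{n-1}(q)_n (cq)_{N-n}c^{n-1}}{(b)_{n-1}(cq)_N}\left(\frac{aq^{n-1}}{1-aq^{n-1}}-\frac{bq^{n-1}}{1-bq^{n-1}}\right). \end{align*}
   Context: Here $|q|<1$, $(A)_n=(A;q)_n=(1-A)(1-Aq)\cdots(1-Aq^{n-1})$ with $(A)_0=1$, and $\genfrac{[}{]}{0pt}{}{N}{n}=\frac{(q;q)_N}{(q;q)_n(q;q)_{N-n}}$ for $0\le n\le N$ (and $0$ otherwise) is the $q$-binomial coefficient. -}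

module Defs where

open import Level using (_⊔_)
open import Data.Nat using (ℕ; zero; suc; _∸_; _≤_)
open import Relation.Nullary using (¬_)
open import Algebra.Bundles using (CommutativeRing)

-- A field: a commutative ring with 1 ≠ 0 and a total function `inv`
-- which is a multiplicative inverse on nonzero elements
-- (the value of `inv 0#` is irrelevant; all divisions below are
-- guarded by explicit nonvanishing hypotheses in the statement).
record Field (c ℓ : Level.Level) : Set (Level.suc (c ⊔ ℓ)) where
  field
    commutativeRing : CommutativeRing c ℓ
  open CommutativeRing commutativeRing public
  field
    inv      : Carrier → Carrier
    inv-cong : ∀ {x y} → x ≈ y → inv x ≈ inv y
    1≉0      : ¬ (1# ≈ 0#)
    *-inv    : ∀ x → ¬ (x ≈ 0#) → x * inv x ≈ 1#

module FieldOps {c ℓ} (F : Field c ℓ) where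
  open Field F

  infixl 7 _/_
  _/_ : Carrier → Carrier → Carrier
  x / y = x * inv y

  infixr 8 _^_
  _^_ : Carrier → ℕ → Carrier
  x ^ zero  = 1#
  x ^ suc n = x * (x ^ n)

  poch : (q A : Carrier) → ℕ → Carrier
  poch q A zero    = 1#
  poch q A (suc n) = poch q A n * (1# - A * q ^ n)

  qbinom : (q : Carrier) → ℕ → ℕ → Carrier
  qbinom q N n with n Data.Nat.≤? N
  ... | Relation.Nullary.yes _ = poch q q N / (poch q q n * poch q q (N ∸ n))
  ... | Relation.Nullary.no  _ = 0#

  sum1 : ℕ → (ℕ → Carrier) → Carrier
  sum1 zero    f = 0#
  sum1 (suc N) f = sum1 N f + f (suc N)

module Submission where

-- After cancelling the q-binomial coefficient against (q;q)_n and
-- writing (b/x;q)_n x^n as the homogeneous product (x-b)(x-bq)...(x-bq^{n-1}),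
-- both sides become sums  L_N(a,b,c) = Σ_n ℓ_N(a,b,c;n)  and
-- R_N(a,b,c) = Σ_n r_N(a,b,c;n)  of normalised terms.  Both families satisfy
-- the same first-order recurrence in N,
--    X_{N+1}(a,b,c) = K_N(c) · (W_1(a,b) + δ(b,c) · X_N(aq,bq,c)),
-- with X_0 = 0, so they agree by induction on N.
--   * For R this is immediate: split off the term n = 1.
--   * For L, splitting off n = 1 gives the different recurrence
--     L_{N+1}(a,b,c) = A_N(a,b) · (1/(1-cq) + L_N(a,bq,cq));  the desired one
--     follows by induction on N from it (applied twice) and a single rational
--     identity in a, b, c, q, q^N and L_{N-1}(aq,bq²,cq).

open import Defs
open import Level using (Level)
open import Data.Nat using (ℕ; _∸_; _<_; _≤_)
open import Relation.Nullary using (¬_)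

open import Algebra using (CommutativeRing; RawRing)
open import Data.Nat as ℕ using (zero; suc; z≤n; s≤s; _≤′_; ≤′-refl; ≤′-step)
import Data.Nat.Properties as ℕ
open import Data.Product using (_×_; _,_)
open import Data.Product.Properties using (≡-dec)
open import Data.Maybe using (Maybe; map)
open import Data.Empty using (⊥-elim)
open import Relation.Nullary using (yes; no)
open import Relation.Binary.PropositionalEquality as ≡ using (_≡_)
open import Relation.Binary.Consequences using (dec⇒weaklyDec)

-- Integers
-- are pairs (m , n) standing for m - n, kept normalised (one entry is 0) so
-- that equal integers are syntactically equal; they act on R through
-- ⟦ m , n ⟧ = m·1 - n·1.  The solver itself is the library's
-- Algebra.Solver.Ring, instantiated with this coefficient ring.
module IntegerCoefficientSolver {c ℓ} (R : CommutativeRing c ℓ) where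
  open CommutativeRing R
  open import Algebra.Properties.Ring ring
    using (x≈y⇒x∙y⁻¹≈ε; x∙y⁻¹≈ε⇒x≈y; ⁻¹-anti-homo‿-; -‿+-comm; x[y-z]≈xy-xz; [y-z]x≈yx-zx; -0#≈0#)
  open import Algebra.Properties.Semiring.Mult.TCOptimised semiring
    using (×-homo-+; ×1-homo-*) renaming (_×_ to _times_)
  open import Algebra.Properties.CommutativeSemigroup +-commutativeSemigroup using (interchange)
  open import Algebra.Solver.Ring.AlmostCommutativeRing
  open import Relation.Binary.Reasoning.Setoid setoid

  -- The image n·1 of a natural number (with 1·1 = 1 definitionally).
  ι : ℕ → Carrier
  ι n = n times 1#

  ℤ₂ : Set
  ℤ₂ = ℕ × ℕ

  normalise : ℕ → ℕ → ℤ₂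
  normalise m n = (m ℕ.∸ n , n ℕ.∸ m)

  integers : RawRing _ _
  integers = record
    { Carrier = ℤ₂
    ; _≈_ = _≡_
    ; _+_ = λ { (m , n) (m′ , n′) → normalise (m ℕ.+ m′) (n ℕ.+ n′) }
    ; _*_ = λ { (m , n) (m′ , n′) → normalise (m ℕ.* m′ ℕ.+ n ℕ.* n′) (m ℕ.* n′ ℕ.+ n ℕ.* m′) }
    ; -_ = λ { (m , n) → (n , m) }
    ; 0# = (0 , 0)
    ; 1# = (1 , 0)
    }

  -- The meaning m·1 - n·1 of a pair; the interpretation ⟦_⟧ handed to the
  -- solver agrees with it but sends (1 , 0) to 1# on the nose, so that the
  -- constant 1 of the solver is literally 1#.
  difference : ℤ₂ → Carrier
  difference (m , n) = ι m - ι n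

  ⟦_⟧ : ℤ₂ → Carrier
  ⟦ m , zero ⟧  = ι m
  ⟦ m , suc n ⟧ = difference (m , suc n)

  ⟦⟧≈difference : ∀ p → ⟦ p ⟧ ≈ difference p
  ⟦⟧≈difference (m , zero)  = sym (trans (+-congˡ -0#≈0#) (+-identityʳ (ι m)))
  ⟦⟧≈difference (m , suc n) = refl

  difference-cong : ∀ {x y x′ y′} → x + y′ ≈ x′ + y → x - y ≈ x′ - y′
  difference-cong {x} {y} {x′} {y′} e = x∙y⁻¹≈ε⇒x≈y _ _ (begin
    (x - y) - (x′ - y′)          ≈⟨ +-congˡ (⁻¹-anti-homo‿- x′ y′) ⟩
    (x - y) + (y′ - x′)          ≈⟨ interchange x (- y) y′ (- x′) ⟩
    (x + y′) + (- y - x′)        ≈⟨ +-congˡ (-‿+-comm y x′) ⟩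
    (x + y′) - (y + x′)          ≈⟨ +-congˡ (-‿cong (+-comm y x′)) ⟩
    (x + y′) - (x′ + y)          ≈⟨ x≈y⇒x∙y⁻¹≈ε e ⟩
    0#                           ∎)

  normalise-correct : ∀ m n → difference (normalise m n) ≈ difference (m , n)
  normalise-correct m n = difference-cong (begin
    ι (m ℕ.∸ n) + ι n             ≈⟨ ×-homo-+ 1# (m ℕ.∸ n) n ⟨
    ι ((m ℕ.∸ n) ℕ.+ n)           ≡⟨ ≡.cong ι (balance m n) ⟩
    ι (m ℕ.+ (n ℕ.∸ m))           ≈⟨ ×-homo-+ 1# m (n ℕ.∸ m) ⟩
    ι m + ι (n ℕ.∸ m)             ∎)
    where
    balance : ∀ m n → (m ℕ.∸ n) ℕ.+ n ≡ m ℕ.+ (n ℕ.∸ m)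
    balance zero    zero    = ≡.refl
    balance zero    (suc n) = ≡.refl
    balance (suc m) zero    = ≡.refl
    balance (suc m) (suc n) = ≡.trans (ℕ.+-suc (m ℕ.∸ n) n) (≡.cong suc (balance m n))

  difference-+ : ∀ a b c d → (a + c) - (b + d) ≈ (a - b) + (c - d)
  difference-+ a b c d = begin
    (a + c) - (b + d)          ≈⟨ +-congˡ (-‿+-comm b d) ⟨
    (a + c) + (- b - d)        ≈⟨ interchange a (- b) c (- d) ⟨
    (a - b) + (c - d)          ∎

  difference-* : ∀ a b c d → (a * c + b * d) - (a * d + b * c) ≈ (a - b) * (c - d)
  difference-* a b c d = sym (begin
    (a - b) * (c - d)                     ≈⟨ [y-z]x≈yx-zx (c - d) a b ⟩
    a * (c - d) - b * (c - d)             ≈⟨ +-cong (x[y-z]≈xy-xz a c d) (-‿cong (x[y-z]≈xy-xz b c d)) ⟩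
    (a * c - a * d) - (b * c - b * d)     ≈⟨ +-congˡ (⁻¹-anti-homo‿- (b * c) (b * d)) ⟩
    (a * c - a * d) + (b * d - b * c)     ≈⟨ interchange (a * c) (- (a * d)) (b * d) (- (b * c)) ⟩
    (a * c + b * d) + (- (a * d) - b * c) ≈⟨ +-congˡ (-‿+-comm (a * d) (b * c)) ⟩
    (a * c + b * d) - (a * d + b * c)     ∎)

  morphism : integers -Raw-AlmostCommutative⟶ fromCommutativeRing R
  morphism = record
    { ⟦_⟧    = ⟦_⟧
    ; +-homo = +-homo
    ; *-homo = *-homo
    ; -‿homo = -‿homo
    ; 0-homo = refl
    ; 1-homo = refl
    }
    where
    +-homo : ∀ p p′ → ⟦ RawRing._+_ integers p p′ ⟧ ≈ ⟦ p ⟧ + ⟦ p′ ⟧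
    +-homo (m , n) (m′ , n′) = begin
      ⟦ normalise (m ℕ.+ m′) (n ℕ.+ n′) ⟧       ≈⟨ ⟦⟧≈difference (normalise (m ℕ.+ m′) (n ℕ.+ n′)) ⟩
      difference (normalise (m ℕ.+ m′) (n ℕ.+ n′)) ≈⟨ normalise-correct (m ℕ.+ m′) (n ℕ.+ n′) ⟩
      ι (m ℕ.+ m′) - ι (n ℕ.+ n′)               ≈⟨ +-cong (×-homo-+ 1# m m′) (-‿cong (×-homo-+ 1# n n′)) ⟩
      (ι m + ι m′) - (ι n + ι n′)               ≈⟨ difference-+ (ι m) (ι n) (ι m′) (ι n′) ⟩
      (ι m - ι n) + (ι m′ - ι n′)               ≈⟨ +-cong (⟦⟧≈difference (m , n)) (⟦⟧≈difference (m′ , n′)) ⟨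
      ⟦ m , n ⟧ + ⟦ m′ , n′ ⟧                   ∎
    *-homo : ∀ p p′ → ⟦ RawRing._*_ integers p p′ ⟧ ≈ ⟦ p ⟧ * ⟦ p′ ⟧
    *-homo (m , n) (m′ , n′) = begin
      ⟦ normalise (m ℕ.* m′ ℕ.+ n ℕ.* n′) (m ℕ.* n′ ℕ.+ n ℕ.* m′) ⟧
        ≈⟨ ⟦⟧≈difference (normalise (m ℕ.* m′ ℕ.+ n ℕ.* n′) (m ℕ.* n′ ℕ.+ n ℕ.* m′)) ⟩
      difference (normalise (m ℕ.* m′ ℕ.+ n ℕ.* n′) (m ℕ.* n′ ℕ.+ n ℕ.* m′))
        ≈⟨ normalise-correct (m ℕ.* m′ ℕ.+ n ℕ.* n′) (m ℕ.* n′ ℕ.+ n ℕ.* m′) ⟩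
      ι (m ℕ.* m′ ℕ.+ n ℕ.* n′) - ι (m ℕ.* n′ ℕ.+ n ℕ.* m′)
        ≈⟨ +-cong (ι-sum-of-products m m′ n n′) (-‿cong (ι-sum-of-products m n′ n m′)) ⟩
      (ι m * ι m′ + ι n * ι n′) - (ι m * ι n′ + ι n * ι m′)
        ≈⟨ difference-* (ι m) (ι n) (ι m′) (ι n′) ⟩
      (ι m - ι n) * (ι m′ - ι n′)
        ≈⟨ *-cong (⟦⟧≈difference (m , n)) (⟦⟧≈difference (m′ , n′)) ⟨
      ⟦ m , n ⟧ * ⟦ m′ , n′ ⟧ ∎
      where
      ι-sum-of-products : ∀ a b c d → ι (a ℕ.* b ℕ.+ c ℕ.* d) ≈ ι a * ι b + ι c * ι d
      ι-sum-of-products a b c d = trans (×-homo-+ 1# (a ℕ.* b) (c ℕ.* d)) (+-cong (×1-homo-* a b) (×1-homo-* c d))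
    -‿homo : ∀ p → ⟦ RawRing.-_ integers p ⟧ ≈ - ⟦ p ⟧
    -‿homo (m , n) = begin
      ⟦ n , m ⟧        ≈⟨ ⟦⟧≈difference (n , m) ⟩
      ι n - ι m        ≈⟨ ⁻¹-anti-homo‿- (ι m) (ι n) ⟨
      - (ι m - ι n)    ≈⟨ -‿cong (⟦⟧≈difference (m , n)) ⟨
      - ⟦ m , n ⟧      ∎

  _≟_ : ∀ p p′ → Maybe (⟦ p ⟧ ≈ ⟦ p′ ⟧)
  p ≟ p′ = map (λ { ≡.refl → refl }) (dec⇒weaklyDec (≡-dec ℕ._≟_ ℕ._≟_) p p′)

  open import Algebra.Solver.Ring integers (fromCommutativeRing R) morphism _≟_ public
    using (Polynomial; solve; _:=_; _:+_; _:*_; _:-_; con)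

module FieldFacts {c ℓ} (F : Field c ℓ) where
  open Field F
  open import Algebra.Properties.Ring ring using (x∙y⁻¹≈ε⇒x≈y)
  open import Algebra.Properties.CommutativeSemigroup *-commutativeSemigroup
    renaming (interchange to *-interchange)
  open import Relation.Binary.Reasoning.Setoid setoid

  NonZero : Carrier → Set ℓ
  NonZero x = ¬ (x ≈ 0#)

  *-invˡ : ∀ {x} → NonZero x → inv x * x ≈ 1#
  *-invˡ {x} x≉0 = trans (*-comm (inv x) x) (*-inv x x≉0)

  cancelˡ : ∀ {u v w} → NonZero u → u * v ≈ w → v ≈ inv u * w
  cancelˡ {u} {v} {w} u≉0 e = begin
    v               ≈⟨ *-identityˡ v ⟨
    1# * v          ≈⟨ *-congʳ (*-invˡ u≉0) ⟨
    (inv u * u) * v ≈⟨ *-assoc (inv u) u v ⟩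
    inv u * (u * v) ≈⟨ *-congˡ e ⟩
    inv u * w       ∎

  *-nonzero : ∀ {x y} → NonZero x → NonZero y → NonZero (x * y)
  *-nonzero {x} {y} x≉0 y≉0 xy≈0 = y≉0 (trans (cancelˡ x≉0 xy≈0) (zeroʳ (inv x)))

  nonzero-*ˡ : ∀ {x y} → NonZero (x * y) → NonZero x
  nonzero-*ˡ {x} {y} xy≉0 x≈0 = xy≉0 (trans (*-congʳ x≈0) (zeroˡ y))

  inv-unique : ∀ {u v} → NonZero u → u * v ≈ 1# → v ≈ inv u
  inv-unique {u} u≉0 e = trans (cancelˡ u≉0 e) (*-identityʳ (inv u))

  inv-* : ∀ {x y} → NonZero x → NonZero y → inv (x * y) ≈ inv x * inv y
  inv-* {x} {y} x≉0 y≉0 = sym (inv-unique (*-nonzero x≉0 y≉0) (begin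
    (x * y) * (inv x * inv y)   ≈⟨ *-interchange x y (inv x) (inv y) ⟩
    (x * inv x) * (y * inv y)   ≈⟨ *-cong (*-inv x x≉0) (*-inv y y≉0) ⟩
    1# * 1#                     ≈⟨ *-identityˡ 1# ⟩
    1#                          ∎))

  cancel-inverse : ∀ {x z} → NonZero x → (x * inv x) * z ≈ z
  cancel-inverse {x} {z} x≉0 = trans (*-congʳ (*-inv x x≉0)) (*-identityˡ z)

  cancel-inverses : ∀ {x y z} → NonZero x → NonZero y → ((x * inv x) * (y * inv y)) * z ≈ z
  cancel-inverses {x} {y} {z} x≉0 y≉0 =
    trans (*-assoc (x * inv x) (y * inv y) z) (trans (*-congˡ (cancel-inverse y≉0)) (cancel-inverse x≉0))

  -- Multiplying by (a product of) factors equal to 1; used to clear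
  -- denominators before handing a rational identity to the ring solver.
  insert-one : ∀ {e} x → e ≈ 1# → x ≈ x * e
  insert-one x e≈1 = sym (trans (*-congˡ e≈1) (*-identityʳ x))

  one³ : ∀ {x y z} → x ≈ 1# → y ≈ 1# → z ≈ 1# → x * y * z ≈ 1#
  one³ x≈1 y≈1 z≈1 = trans (*-cong (trans (*-cong x≈1 y≈1) (*-identityˡ 1#)) z≈1) (*-identityˡ 1#)

  inv-1 : inv 1# ≈ 1#
  inv-1 = sym (inv-unique 1≉0 (*-identityˡ 1#))

  1-nonzero : ∀ {x} → ¬ (x ≈ 1#) → NonZero (1# - x)
  1-nonzero {x} x≉1 1-x≈0 = x≉1 (sym (x∙y⁻¹≈ε⇒x≈y 1# x 1-x≈0))

module QCalculus {c ℓ} (F : Field c ℓ) (q : Field.Carrier F) where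
  open Field F
  open FieldOps F
  open FieldFacts F
  open IntegerCoefficientSolver commutativeRing
  open import Relation.Binary.Reasoning.Setoid setoid

  𝟙 : ∀ {n} → Polynomial n
  𝟙 = con (1 , 0)

  poch-shift : ∀ A n → poch q A (suc n) ≈ (1# - A) * poch q (A * q) n
  poch-shift A zero = solve 1 (λ A → 𝟙 :* (𝟙 :- A :* 𝟙) := (𝟙 :- A) :* 𝟙) refl A
  poch-shift A (suc n) = begin
    poch q A (suc n) * (1# - A * (q * q ^ n))          ≈⟨ *-congʳ (poch-shift A n) ⟩
    (1# - A) * poch q (A * q) n * (1# - A * (q * q ^ n))
      ≈⟨ solve 4 (λ A P q Qn → (𝟙 :- A) :* P :* (𝟙 :- A :* (q :* Qn))
                              := (𝟙 :- A) :* (P :* (𝟙 :- (A :* q) :* Qn))) refl A (poch q (A * q) n) q (q ^ n) ⟩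
    (1# - A) * poch q (A * q) (suc n)                  ∎

  inv-poch-shift : ∀ b m → NonZero (1# - b * 1#) → NonZero (poch q (b * q) m) →
    inv (poch q b (suc m)) ≈ inv (1# - b * 1#) * inv (poch q (b * q) m)
  inv-poch-shift b m 1-b≉0 bqm≉0 = begin
    inv (poch q b (suc m))                  ≈⟨ inv-cong (poch-shift b m) ⟩
    inv ((1# - b) * poch q (b * q) m)       ≈⟨ inv-cong (*-congʳ (+-congˡ (-‿cong (*-identityʳ b)))) ⟨
    inv ((1# - b * 1#) * poch q (b * q) m)  ≈⟨ inv-* 1-b≉0 bqm≉0 ⟩
    inv (1# - b * 1#) * inv (poch q (b * q) m) ∎

  hpoch : Carrier → Carrier → ℕ → Carrier
  hpoch x b zero    = 1#
  hpoch x b (suc n) = hpoch x b n * (x - b * q ^ n)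

  -- (b/x;q)_n x^n = (x - b)(x - bq)...(x - bq^{n-1}) for x ≠ 0: this removes
  -- the division by a and by c inside the Pochhammer symbols of the statement.
  poch-div≈hpoch : ∀ {x} b → NonZero x → ∀ n → poch q (b / x) n * x ^ n ≈ hpoch x b n
  poch-div≈hpoch b x≉0 zero = *-identityˡ 1#
  poch-div≈hpoch {x} b x≉0 (suc n) = begin
    poch q (b / x) n * (1# - (b * inv x) * q ^ n) * (x * x ^ n)
      ≈⟨ solve 6 (λ P X x ix b Qn → P :* (𝟙 :- (b :* ix) :* Qn) :* (x :* X)
                                   := (P :* X) :* (x :- (b :* Qn) :* (x :* ix))) refl
           (poch q (b / x) n) (x ^ n) x (inv x) b (q ^ n) ⟩
    (poch q (b / x) n * x ^ n) * (x - (b * q ^ n) * (x * inv x))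
      ≈⟨ *-cong (poch-div≈hpoch b x≉0 n) (+-congˡ (-‿cong (trans (*-congˡ (*-inv x x≉0)) (*-identityʳ _)))) ⟩
    hpoch x b n * (x - b * q ^ n) ∎

  hpoch-shift : ∀ x b n → hpoch x b (suc n) ≈ (x - b) * hpoch x (b * q) n
  hpoch-shift x b zero = solve 2 (λ x b → 𝟙 :* (x :- b :* 𝟙) := (x :- b) :* 𝟙) refl x b
  hpoch-shift x b (suc n) = begin
    hpoch x b (suc n) * (x - b * (q * q ^ n))           ≈⟨ *-congʳ (hpoch-shift x b n) ⟩
    (x - b) * hpoch x (b * q) n * (x - b * (q * q ^ n))
      ≈⟨ solve 5 (λ x b P q Qn → (x :- b) :* P :* (x :- b :* (q :* Qn))
                                := (x :- b) :* (P :* (x :- (b :* q) :* Qn))) refl x b (hpoch x (b * q) n) q (q ^ n) ⟩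
    (x - b) * hpoch x (b * q) (suc n)                   ∎

  AvoidsOne : ℕ → Carrier → Set ℓ
  AvoidsOne N A = ∀ k → k < N → ¬ (A * q ^ k ≈ 1#)

  AvoidsOne⁺ : ℕ → Carrier → Set ℓ
  AvoidsOne⁺ N A = ∀ k → 1 ≤ k → k ≤ N → ¬ (A * q ^ k ≈ 1#)

  ≉1-resp : ∀ {x y} → x ≈ y → ¬ (x ≈ 1#) → ¬ (y ≈ 1#)
  ≉1-resp x≈y x≉1 y≈1 = x≉1 (trans x≈y y≈1)

  shift-power : ∀ A k → A * q ^ suc k ≈ (A * q) * q ^ k
  shift-power A k = sym (*-assoc A q (q ^ k))

  inv-shift : ∀ A k → inv (1# - A * q ^ suc k) ≈ inv (1# - (A * q) * q ^ k)
  inv-shift A k = inv-cong (+-congˡ (-‿cong (shift-power A k)))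

  avoids-≤ : ∀ {m N A} → m ≤ N → AvoidsOne N A → AvoidsOne m A
  avoids-≤ m≤N h k k<m = h k (ℕ.<-≤-trans k<m m≤N)

  avoids-shift : ∀ {N A} → AvoidsOne (suc N) A → AvoidsOne N (A * q)
  avoids-shift {A = A} h k k<N = ≉1-resp (shift-power A k) (h (suc k) (s≤s k<N))

  avoids⁺-≤ : ∀ {m N A} → m ≤ N → AvoidsOne⁺ N A → AvoidsOne⁺ m A
  avoids⁺-≤ m≤N h k 1≤k k≤m = h k 1≤k (ℕ.≤-trans k≤m m≤N)

  avoids⁺⇒avoids-shift : ∀ {N A} → AvoidsOne⁺ N A → AvoidsOne N (A * q)
  avoids⁺⇒avoids-shift {A = A} h k k<N = ≉1-resp (shift-power A k) (h (suc k) (s≤s z≤n) k<N)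

  avoids⁺-shift : ∀ {N A} → AvoidsOne⁺ (suc N) A → AvoidsOne⁺ N (A * q)
  avoids⁺-shift {A = A} h k _ k≤N = ≉1-resp (shift-power A k) (h (suc k) (s≤s z≤n) (s≤s k≤N))

  poch-nonzero : ∀ {A} n → AvoidsOne n A → NonZero (poch q A n)
  poch-nonzero zero    h = 1≉0
  poch-nonzero (suc n) h = *-nonzero (poch-nonzero n (avoids-≤ (ℕ.n≤1+n n) h)) (1-nonzero (h n ℕ.≤-refl))

  poch-prefix : ∀ {A k N} → k ≤′ N → NonZero (poch q A N) → NonZero (poch q A k)
  poch-prefix ≤′-refl       h = h
  poch-prefix (≤′-step k≤N) h = poch-prefix k≤N (nonzero-*ˡ h)

  sum1-cong : ∀ N {f g : ℕ → Carrier} → (∀ n → 1 ≤ n → n ≤ N → f n ≈ g n) → sum1 N f ≈ sum1 N g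
  sum1-cong zero    e = refl
  sum1-cong (suc N) e = +-cong (sum1-cong N (λ n 1≤n n≤N → e n 1≤n (ℕ.m≤n⇒m≤1+n n≤N)))
                               (e (suc N) (s≤s z≤n) ℕ.≤-refl)

  sum1-peel : ∀ N (f : ℕ → Carrier) → sum1 (suc N) f ≈ f 1 + sum1 N (λ n → f (suc n))
  sum1-peel zero    f = +-comm 0# (f 1)
  sum1-peel (suc N) f = trans (+-congʳ (sum1-peel N f)) (+-assoc _ _ _)

  sum1-*ˡ : ∀ N k (f : ℕ → Carrier) → sum1 N (λ n → k * f n) ≈ k * sum1 N f
  sum1-*ˡ zero    k f = sym (zeroʳ k)
  sum1-*ˡ (suc N) k f = trans (+-congʳ (sum1-*ˡ N k f)) (sym (distribˡ k (sum1 N f) (f (suc N))))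

module NormalisedSums {c ℓ} (F : Field c ℓ) (q : Field.Carrier F) where
  open Field F
  open FieldOps F
  open FieldFacts F
  open QCalculus F q
  open IntegerCoefficientSolver commutativeRing using (solve; _:=_; _:+_; _:*_; _:-_; con)
  open import Relation.Binary.Reasoning.Setoid setoid

  record Admissible (N : ℕ) (a b c : Carrier) : Set ℓ where
    field
      qq≉0     : NonZero (poch q q N)
      a-avoids : AvoidsOne N a
      b-avoids : AvoidsOne N b
      c-avoids : AvoidsOne⁺ N c

  N≤′1+N : ∀ N → N ≤′ suc N
  N≤′1+N N = ≤′-step ≤′-refl

  admissible-peel : ∀ {N a b c} → Admissible (suc N) a b c → Admissible N a (b * q) (c * q)
  admissible-peel {N} H = record
    { qq≉0 = poch-prefix (N≤′1+N N) qq≉0 ; a-avoids = avoids-≤ (ℕ.n≤1+n N) a-avoids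
    ; b-avoids = avoids-shift b-avoids ; c-avoids = avoids⁺-shift c-avoids }
    where open Admissible H

  admissible-shift : ∀ {N a b c} → Admissible (suc N) a b c → Admissible N (a * q) (b * q) c
  admissible-shift {N} H = record
    { qq≉0 = poch-prefix (N≤′1+N N) qq≉0 ; a-avoids = avoids-shift a-avoids
    ; b-avoids = avoids-shift b-avoids ; c-avoids = avoids⁺-≤ (ℕ.n≤1+n N) c-avoids }
    where open Admissible H

  leftTerm : ℕ → Carrier → Carrier → Carrier → ℕ → Carrier
  leftTerm N a b c n =
    poch q q N * inv (poch q q (N ∸ n)) * hpoch a b n * poch q a (N ∸ n)
    * inv (1# - c * q ^ n) * inv (poch q b n) * inv (poch q a N)

  leftSum : ℕ → Carrier → Carrier → Carrier → Carrier
  leftSum N a b c = sum1 N (leftTerm N a b c)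

  W : ℕ → Carrier → Carrier → Carrier
  W n a b = (a * q ^ (n ∸ 1)) / (1# - a * q ^ (n ∸ 1)) - (b * q ^ (n ∸ 1)) / (1# - b * q ^ (n ∸ 1))

  rightTerm : ℕ → Carrier → Carrier → Carrier → ℕ → Carrier
  rightTerm N a b c n =
    poch q q N * inv (poch q q (N ∸ n)) * poch q (c * q) (N ∸ n) * inv (poch q (c * q) N)
    * hpoch c b (n ∸ 1) * inv (poch q b (n ∸ 1)) * W n a b

  rightSum : ℕ → Carrier → Carrier → Carrier → Carrier
  rightSum N a b c = sum1 N (rightTerm N a b c)

  K : ℕ → Carrier → Carrier
  K N c = (1# - q * q ^ N) * inv (1# - c * (q * q ^ N))

  δ : Carrier → Carrier → Carrier
  δ b c = (c - b) * inv (1# - b * 1#)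

  peelFactor : ℕ → Carrier → Carrier → Carrier
  peelFactor N a b = (1# - q * q ^ N) * (a - b) * inv (1# - a * q ^ N) * inv (1# - b * 1#)

  inv[1-cq] : Carrier → Carrier
  inv[1-cq] c = inv (1# - c * (q * 1#))

  leftSum-peel : ∀ {N a b c} → Admissible (suc N) a b c →
    leftSum (suc N) a b c ≈ peelFactor N a b * (inv[1-cq] c + leftSum N a (b * q) (c * q))
  leftSum-peel {N} {a} {b} {c} H = begin
    leftSum (suc N) a b c
      ≈⟨ sum1-peel N (leftTerm (suc N) a b c) ⟩
    leftTerm (suc N) a b c 1 + sum1 N (λ m → leftTerm (suc N) a b c (suc m))
      ≈⟨ +-cong first-term (sum1-cong N later-terms) ⟩
    peelFactor N a b * inv[1-cq] c + sum1 N (λ m → peelFactor N a b * leftTerm N a (b * q) (c * q) m)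
      ≈⟨ +-congˡ (sum1-*ˡ N (peelFactor N a b) _) ⟩
    peelFactor N a b * inv[1-cq] c + peelFactor N a b * leftSum N a (b * q) (c * q)
      ≈⟨ distribˡ _ _ _ ⟨
    peelFactor N a b * (inv[1-cq] c + leftSum N a (b * q) (c * q)) ∎
    where
    open Admissible H
    qqN≉0 : NonZero (poch q q N)
    qqN≉0 = nonzero-*ˡ qq≉0
    aN≉0 : NonZero (poch q a N)
    aN≉0 = poch-nonzero N (avoids-≤ (ℕ.n≤1+n N) a-avoids)
    1-aq^N≉0 : NonZero (1# - a * q ^ N)
    1-aq^N≉0 = 1-nonzero (a-avoids N ℕ.≤-refl)
    1-b≉0 : NonZero (1# - b * 1#)
    1-b≉0 = 1-nonzero (b-avoids 0 (s≤s z≤n))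
    inv-aN+1 : inv (poch q a (suc N)) ≈ inv (poch q a N) * inv (1# - a * q ^ N)
    inv-aN+1 = inv-* aN≉0 1-aq^N≉0

    first-term : leftTerm (suc N) a b c 1 ≈ peelFactor N a b * inv[1-cq] c
    first-term = begin
      poch q q N * (1# - q * q ^ N) * inv (poch q q N) * (1# * (a - b * 1#)) * poch q a N
        * inv[1-cq] c * inv (1# * (1# - b * 1#)) * inv (poch q a (suc N))
        ≈⟨ *-cong (*-congˡ (inv-cong (*-identityˡ _))) inv-aN+1 ⟩
      poch q q N * (1# - q * q ^ N) * inv (poch q q N) * (1# * (a - b * 1#)) * poch q a N
        * inv[1-cq] c * inv (1# - b * 1#) * (inv (poch q a N) * inv (1# - a * q ^ N))
        ≈⟨ solve 10 (λ qN D iqN a b AN ic ib iAN iaN →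
              qN :* D :* iqN :* (𝟙 :* (a :- b :* 𝟙)) :* AN :* ic :* ib :* (iAN :* iaN)
              := ((qN :* iqN) :* (AN :* iAN)) :* (D :* (a :- b) :* iaN :* ib :* ic)) refl
              (poch q q N) (1# - q * q ^ N) (inv (poch q q N)) a b (poch q a N)
              (inv[1-cq] c) (inv (1# - b * 1#)) (inv (poch q a N)) (inv (1# - a * q ^ N)) ⟩
      ((poch q q N * inv (poch q q N)) * (poch q a N * inv (poch q a N))) * (peelFactor N a b * inv[1-cq] c)
        ≈⟨ cancel-inverses qqN≉0 aN≉0 ⟩
      peelFactor N a b * inv[1-cq] c ∎

    later-terms : ∀ m → 1 ≤ m → m ≤ N →
      leftTerm (suc N) a b c (suc m) ≈ peelFactor N a b * leftTerm N a (b * q) (c * q) m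
    later-terms m _ m≤N = begin
      poch q q N * (1# - q * q ^ N) * inv (poch q q (N ∸ m)) * hpoch a b (suc m) * poch q a (N ∸ m)
        * inv (1# - c * q ^ suc m) * inv (poch q b (suc m)) * inv (poch q a (suc N))
        ≈⟨ *-cong (*-cong (*-cong (*-congʳ (*-congˡ (hpoch-shift a b m))) (inv-shift c m))
                          (inv-poch-shift b m 1-b≉0 bqm≉0))
                  inv-aN+1 ⟩
      poch q q N * (1# - q * q ^ N) * inv (poch q q (N ∸ m)) * ((a - b) * hpoch a (b * q) m) * poch q a (N ∸ m)
        * inv (1# - (c * q) * q ^ m) * (inv (1# - b * 1#) * inv (poch q (b * q) m))
        * (inv (poch q a N) * inv (1# - a * q ^ N))
        ≈⟨ solve 12 (λ qN D iqNm a b Pm ANm icm ib ibm iAN iaN →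
              qN :* D :* iqNm :* ((a :- b) :* Pm) :* ANm :* icm :* (ib :* ibm) :* (iAN :* iaN)
              := (D :* (a :- b) :* iaN :* ib) :* (qN :* iqNm :* Pm :* ANm :* icm :* ibm :* iAN)) refl
              (poch q q N) (1# - q * q ^ N) (inv (poch q q (N ∸ m))) a b (hpoch a (b * q) m)
              (poch q a (N ∸ m)) (inv (1# - (c * q) * q ^ m)) (inv (1# - b * 1#))
              (inv (poch q (b * q) m)) (inv (poch q a N)) (inv (1# - a * q ^ N)) ⟩
      peelFactor N a b * leftTerm N a (b * q) (c * q) m ∎
      where
      bqm≉0 : NonZero (poch q (b * q) m)
      bqm≉0 = poch-nonzero m (avoids-≤ m≤N (avoids-shift b-avoids))

  W-shift : ∀ k a b → W (suc (suc k)) a b ≈ W (suc k) (a * q) (b * q)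
  W-shift k a b = +-cong (*-cong (shift-power a k) (inv-shift a k))
                         (-‿cong (*-cong (shift-power b k) (inv-shift b k)))

  rightSum-recurrence : ∀ {N a b c} → Admissible (suc N) a b c →
    rightSum (suc N) a b c ≈ K N c * (W 1 a b + δ b c * rightSum N (a * q) (b * q) c)
  rightSum-recurrence {N} {a} {b} {c} H = begin
    rightSum (suc N) a b c
      ≈⟨ sum1-peel N (rightTerm (suc N) a b c) ⟩
    rightTerm (suc N) a b c 1 + sum1 N (λ m → rightTerm (suc N) a b c (suc m))
      ≈⟨ +-cong first-term (sum1-cong N later-terms) ⟩
    K N c * W 1 a b + sum1 N (λ m → K N c * (δ b c * rightTerm N (a * q) (b * q) c m))
      ≈⟨ +-congˡ (trans (sum1-*ˡ N (K N c) _) (*-congˡ (sum1-*ˡ N (δ b c) _))) ⟩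
    K N c * W 1 a b + K N c * (δ b c * rightSum N (a * q) (b * q) c)
      ≈⟨ distribˡ _ _ _ ⟨
    K N c * (W 1 a b + δ b c * rightSum N (a * q) (b * q) c) ∎
    where
    open Admissible H
    qqN≉0 : NonZero (poch q q N)
    qqN≉0 = nonzero-*ˡ qq≉0
    cqN≉0 : NonZero (poch q (c * q) N)
    cqN≉0 = poch-nonzero N (avoids⁺⇒avoids-shift (avoids⁺-≤ (ℕ.n≤1+n N) c-avoids))
    1-cq^N+1≉0 : NonZero (1# - (c * q) * q ^ N)
    1-cq^N+1≉0 = 1-nonzero (≉1-resp (shift-power c N) (c-avoids (suc N) (s≤s z≤n) ℕ.≤-refl))
    1-b≉0 : NonZero (1# - b * 1#)
    1-b≉0 = 1-nonzero (b-avoids 0 (s≤s z≤n))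
    inv-cqN+1 : inv (poch q (c * q) (suc N)) ≈ inv (poch q (c * q) N) * inv (1# - c * (q * q ^ N))
    inv-cqN+1 = trans (inv-* cqN≉0 1-cq^N+1≉0) (*-congˡ (sym (inv-shift c N)))

    first-term : rightTerm (suc N) a b c 1 ≈ K N c * W 1 a b
    first-term = begin
      poch q q N * (1# - q * q ^ N) * inv (poch q q N) * poch q (c * q) N
        * inv (poch q (c * q) (suc N)) * 1# * inv 1# * W 1 a b
        ≈⟨ *-congʳ (*-cong (*-congʳ (*-congˡ inv-cqN+1)) inv-1) ⟩
      poch q q N * (1# - q * q ^ N) * inv (poch q q N) * poch q (c * q) N
        * (inv (poch q (c * q) N) * inv (1# - c * (q * q ^ N))) * 1# * 1# * W 1 a b
        ≈⟨ solve 7 (λ qN D iqN CN iCN ic w →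
              qN :* D :* iqN :* CN :* (iCN :* ic) :* 𝟙 :* 𝟙 :* w
              := ((qN :* iqN) :* (CN :* iCN)) :* (D :* ic :* w)) refl
              (poch q q N) (1# - q * q ^ N) (inv (poch q q N)) (poch q (c * q) N)
              (inv (poch q (c * q) N)) (inv (1# - c * (q * q ^ N))) (W 1 a b) ⟩
      ((poch q q N * inv (poch q q N)) * (poch q (c * q) N * inv (poch q (c * q) N))) * (K N c * W 1 a b)
        ≈⟨ cancel-inverses qqN≉0 cqN≉0 ⟩
      K N c * W 1 a b ∎

    later-terms : ∀ m → 1 ≤ m → m ≤ N →
      rightTerm (suc N) a b c (suc m) ≈ K N c * (δ b c * rightTerm N (a * q) (b * q) c m)
    later-terms (suc k) _ k+1≤N = begin
      poch q q N * (1# - q * q ^ N) * inv (poch q q (N ∸ suc k)) * poch q (c * q) (N ∸ suc k)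
        * inv (poch q (c * q) (suc N)) * hpoch c b (suc k) * inv (poch q b (suc k)) * W (suc (suc k)) a b
        ≈⟨ *-cong (*-cong (*-cong (*-congˡ inv-cqN+1) (hpoch-shift c b k)) (inv-poch-shift b k 1-b≉0 bqk≉0))
                  (W-shift k a b) ⟩
      poch q q N * (1# - q * q ^ N) * inv (poch q q (N ∸ suc k)) * poch q (c * q) (N ∸ suc k)
        * (inv (poch q (c * q) N) * inv (1# - c * (q * q ^ N))) * ((c - b) * hpoch c (b * q) k)
        * (inv (1# - b * 1#) * inv (poch q (b * q) k)) * W (suc k) (a * q) (b * q)
        ≈⟨ solve 12 (λ qN D iqNm CNm iCN ic c b Pk ib ibk w →
              qN :* D :* iqNm :* CNm :* (iCN :* ic) :* ((c :- b) :* Pk) :* (ib :* ibk) :* w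
              := (D :* ic) :* (((c :- b) :* ib) :* (qN :* iqNm :* CNm :* iCN :* Pk :* ibk :* w))) refl
              (poch q q N) (1# - q * q ^ N) (inv (poch q q (N ∸ suc k))) (poch q (c * q) (N ∸ suc k))
              (inv (poch q (c * q) N)) (inv (1# - c * (q * q ^ N))) c b (hpoch c (b * q) k)
              (inv (1# - b * 1#)) (inv (poch q (b * q) k)) (W (suc k) (a * q) (b * q)) ⟩
      K N c * (δ b c * rightTerm N (a * q) (b * q) c (suc k)) ∎
      where
      bqk≉0 : NonZero (poch q (b * q) k)
      bqk≉0 = poch-nonzero k (avoids-≤ (ℕ.≤-trans (ℕ.n≤1+n k) k+1≤N) (avoids-shift b-avoids))

  -- The rational identity behind the inductive step of the recurrence of L.
  -- Writing Q = q^N, Z = L_N(aq,bq²,cq) and naming the inverses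
  --   ia = 1/(1-a), ib = 1/(1-b), ibq = 1/(1-bq), icq = 1/(1-cq),
  --   iaQ = 1/(1-aq^{N+1}), icQ = 1/(1-cq^{N+2}),
  -- it says  A_{N+1}(a,b) (1/(1-cq) + K_N(cq) (W_1(a,bq) + δ(bq,cq) Z))
  --        = K_{N+1}(c) (W_1(a,b) + δ(b,c) A_N(aq,bq) (1/(1-cq) + Z)).
  -- Multiplying suitable summands by factors (1-x)·(1/(1-x)) = 1 turns it
  -- into a polynomial identity, which the ring solver verifies.
  step-identity : ∀ a b c q Q Z ia ib ibq icq iaQ icQ →
    (1# - a * 1#) * ia ≈ 1# → (1# - b * 1#) * ib ≈ 1# → (1# - (b * q) * 1#) * ibq ≈ 1# →
    (1# - c * (q * 1#)) * icq ≈ 1# → (1# - a * (q * Q)) * iaQ ≈ 1# →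
    (1# - c * (q * (q * Q))) * icQ ≈ 1# →
    ((1# - q * (q * Q)) * (a - b) * iaQ * ib)
      * (icq + ((1# - q * Q) * icQ) * (((a * 1#) * ia - ((b * q) * 1#) * ibq) + ((c * q) - (b * q)) * ibq * Z))
    ≈ ((1# - q * (q * Q)) * icQ)
      * (((a * 1#) * ia - (b * 1#) * ib) + ((c - b) * ib) * (((1# - q * Q) * ((a * q) - (b * q)) * iaQ * ibq) * (icq + Z)))
  step-identity a b c q Q Z ia ib ibq icq iaQ icQ ea eb ebq ecq eaQ ecQ = begin
    ((1# - q * (q * Q)) * (a - b) * iaQ * ib)
      * (icq + ((1# - q * Q) * icQ) * (((a * 1#) * ia - ((b * q) * 1#) * ibq) + ((c * q) - (b * q)) * ibq * Z))
      ≈⟨ *-congˡ (+-cong (insert-one icq (one³ ea ebq ecQ))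
                         (*-congˡ (+-congʳ (trans (+-cong (insert-one _ ebq) (-‿cong (insert-one _ ea)))
                                                  (insert-one _ ecq))))) ⟩
    ((1# - q * (q * Q)) * (a - b) * iaQ * ib)
      * (icq * (Ea * Ebq * EcQ)
         + ((1# - q * Q) * icQ) * ((((a * 1#) * ia) * Ebq - (((b * q) * 1#) * ibq) * Ea) * Ecq
                                   + ((c * q) - (b * q)) * ibq * Z))
      ≈⟨ solve 12 (λ a b c q Q Z ia ib ibq icq iaQ icQ →
          let Ea  = (𝟙 :- a :* 𝟙) :* ia
              Eb  = (𝟙 :- b :* 𝟙) :* ib
              Ebq = (𝟙 :- (b :* q) :* 𝟙) :* ibq
              Ecq = (𝟙 :- c :* (q :* 𝟙)) :* icq
              EaQ = (𝟙 :- a :* (q :* Q)) :* iaQ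
              EcQ = (𝟙 :- c :* (q :* (q :* Q))) :* icQ
          in ((𝟙 :- q :* (q :* Q)) :* (a :- b) :* iaQ :* ib)
               :* (icq :* (Ea :* Ebq :* EcQ)
                   :+ ((𝟙 :- q :* Q) :* icQ) :* ((((a :* 𝟙) :* ia) :* Ebq :- (((b :* q) :* 𝟙) :* ibq) :* Ea) :* Ecq
                                                 :+ ((c :* q) :- (b :* q)) :* ibq :* Z))
             := ((𝟙 :- q :* (q :* Q)) :* icQ)
               :* ((((a :* 𝟙) :* ia) :* Eb :- ((b :* 𝟙) :* ib) :* Ea) :* (Ebq :* Ecq :* EaQ)
                   :+ ((c :- b) :* ib) :* (((𝟙 :- q :* Q) :* ((a :* q) :- (b :* q)) :* iaQ :* ibq) :* (icq :* Ea :+ Z))))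
          refl a b c q Q Z ia ib ibq icq iaQ icQ ⟩
    ((1# - q * (q * Q)) * icQ)
      * ((((a * 1#) * ia) * Eb - ((b * 1#) * ib) * Ea) * (Ebq * Ecq * EaQ)
         + ((c - b) * ib) * (((1# - q * Q) * ((a * q) - (b * q)) * iaQ * ibq) * (icq * Ea + Z)))
      ≈⟨ *-congˡ (+-cong (trans (+-cong (insert-one _ eb) (-‿cong (insert-one _ ea))) (insert-one _ (one³ ebq ecq eaQ)))
                         (*-congˡ (*-congˡ (+-congʳ (insert-one icq ea))))) ⟨
    ((1# - q * (q * Q)) * icQ)
      * (((a * 1#) * ia - (b * 1#) * ib) + ((c - b) * ib) * (((1# - q * Q) * ((a * q) - (b * q)) * iaQ * ibq) * (icq + Z))) ∎
    where
    Ea  = (1# - a * 1#) * ia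
    Eb  = (1# - b * 1#) * ib
    Ebq = (1# - (b * q) * 1#) * ibq
    Ecq = (1# - c * (q * 1#)) * icq
    EaQ = (1# - a * (q * Q)) * iaQ
    EcQ = (1# - c * (q * (q * Q))) * icQ

  -- The same identity for N = 0, where Z = L_0 = 0 and the K_N(cq) term is absent.
  base-identity : ∀ a b c q ia ib icq → (1# - a * 1#) * ia ≈ 1# → (1# - b * 1#) * ib ≈ 1# →
    ((1# - q * 1#) * (a - b) * ia * ib) * (icq + 0#)
    ≈ ((1# - q * 1#) * icq) * (((a * 1#) * ia - (b * 1#) * ib) + ((c - b) * ib) * 0#)
  base-identity a b c q ia ib icq ea eb = begin
    ((1# - q * 1#) * (a - b) * ia * ib) * (icq + 0#)
      ≈⟨ solve 7 (λ a b c q ia ib icq →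
          let Ea = (𝟙 :- a :* 𝟙) :* ia
              Eb = (𝟙 :- b :* 𝟙) :* ib
          in ((𝟙 :- q :* 𝟙) :* (a :- b) :* ia :* ib) :* (icq :+ con (0 , 0))
             := ((𝟙 :- q :* 𝟙) :* icq) :* ((((a :* 𝟙) :* ia) :* Eb :- ((b :* 𝟙) :* ib) :* Ea) :+ ((c :- b) :* ib) :* con (0 , 0)))
          refl a b c q ia ib icq ⟩
    ((1# - q * 1#) * icq) * ((((a * 1#) * ia) * ((1# - b * 1#) * ib) - ((b * 1#) * ib) * ((1# - a * 1#) * ia)) + ((c - b) * ib) * 0#)
      ≈⟨ *-congˡ (+-congʳ (+-cong (insert-one _ eb) (-‿cong (insert-one _ ea)))) ⟨
    ((1# - q * 1#) * icq) * (((a * 1#) * ia - (b * 1#) * ib) + ((c - b) * ib) * 0#) ∎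

  -- By induction on N: peel L_{N+2}(a,b,c),
  -- use the induction hypothesis for L_{N+1}(a,bq,cq), apply the rational
  -- identity, and fold the result back with the peeling recurrence for
  -- L_{N+1}(aq,bq,c).
  leftSum-recurrence : ∀ N {a b c} → Admissible (suc N) a b c →
    leftSum (suc N) a b c ≈ K N c * (W 1 a b + δ b c * leftSum N (a * q) (b * q) c)
  leftSum-recurrence zero {a} {b} {c} H =
    trans (leftSum-peel H) (base-identity a b c q _ _ _ (*-inv _ (1-nonzero (a-avoids 0 (s≤s z≤n))))
                                                        (*-inv _ (1-nonzero (b-avoids 0 (s≤s z≤n)))))
    where open Admissible H
  leftSum-recurrence (suc N) {a} {b} {c} H = begin
    leftSum (suc (suc N)) a b c
      ≈⟨ leftSum-peel H ⟩
    peelFactor (suc N) a b * (inv[1-cq] c + leftSum (suc N) a (b * q) (c * q))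
      ≈⟨ *-congˡ (+-congˡ (leftSum-recurrence N (admissible-peel H))) ⟩
    peelFactor (suc N) a b * (inv[1-cq] c + K N (c * q) * (W 1 a (b * q) + δ (b * q) (c * q) * Z))
      ≈⟨ *-congˡ (+-congˡ (*-congʳ K-cq)) ⟩
    _ ≈⟨ step-identity a b c q Q Z _ _ _ _ _ _
           (*-inv _ (1-nonzero (a-avoids 0 (s≤s z≤n))))
           (*-inv _ (1-nonzero (b-avoids 0 (s≤s z≤n))))
           (*-inv _ (1-nonzero (avoids-shift b-avoids 0 (s≤s z≤n))))
           (*-inv _ (1-nonzero (c-avoids 1 (s≤s z≤n) (s≤s z≤n))))
           (*-inv _ (1-nonzero (a-avoids (suc N) ℕ.≤-refl)))
           (*-inv _ (1-nonzero (c-avoids (suc (suc N)) (s≤s z≤n) ℕ.≤-refl))) ⟩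
    _ ≈⟨ *-congˡ (+-congˡ (*-congˡ (*-congʳ peelFactor-aq-bq))) ⟨
    K (suc N) c * (W 1 a b + δ b c * (peelFactor N (a * q) (b * q) * (inv[1-cq] c + Z)))
      ≈⟨ *-congˡ (+-congˡ (*-congˡ (leftSum-peel (admissible-shift H)))) ⟨
    K (suc N) c * (W 1 a b + δ b c * leftSum (suc N) (a * q) (b * q) c) ∎
    where
    open Admissible H
    Q = q ^ N
    Z = leftSum N (a * q) ((b * q) * q) (c * q)
    K-cq : K N (c * q) ≈ (1# - q * Q) * inv (1# - c * (q * (q * Q)))
    K-cq = *-congˡ (inv-cong (+-congˡ (-‿cong (*-assoc c q (q * Q)))))
    peelFactor-aq-bq : peelFactor N (a * q) (b * q)
                       ≈ (1# - q * Q) * ((a * q) - (b * q)) * inv (1# - a * (q * Q)) * inv (1# - (b * q) * 1#)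
    peelFactor-aq-bq = *-congʳ (*-congˡ (inv-cong (+-congˡ (-‿cong (*-assoc a q Q)))))

  leftSum≈rightSum : ∀ N {a b c} → Admissible N a b c → leftSum N a b c ≈ rightSum N a b c
  leftSum≈rightSum zero H = refl
  leftSum≈rightSum (suc N) {a} {b} {c} H = begin
    leftSum (suc N) a b c                                    ≈⟨ leftSum-recurrence N H ⟩
    K N c * (W 1 a b + δ b c * leftSum N (a * q) (b * q) c)  ≈⟨ *-congˡ (+-congˡ (*-congˡ (leftSum≈rightSum N (admissible-shift H)))) ⟩
    K N c * (W 1 a b + δ b c * rightSum N (a * q) (b * q) c) ≈⟨ rightSum-recurrence H ⟨
    rightSum (suc N) a b c                                   ∎

  qbinom-inside : ∀ N n → n ≤ N → qbinom q N n ≈ poch q q N / (poch q q n * poch q q (N ∸ n))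
  qbinom-inside N n n≤N with n ℕ.≤? N
  ... | yes _  = refl
  ... | no n≰N = ⊥-elim (n≰N n≤N)

  module Summands (N : ℕ) (a b c : Carrier) (a≉0 : NonZero a) (c≉0 : NonZero c) (H : Admissible N a b c) where
    open Admissible H

    qqn≉0 : ∀ {n} → n ≤ N → NonZero (poch q q n)
    qqn≉0 n≤N = poch-prefix (ℕ.≤⇒≤′ n≤N) qq≉0

    qqN-n≉0 : ∀ n → NonZero (poch q q (N ∸ n))
    qqN-n≉0 n = poch-prefix (ℕ.≤⇒≤′ (ℕ.m∸n≤m N n)) qq≉0

    left-summand : ∀ n → 1 ≤ n → n ≤ N →
      qbinom q N n * ((poch q (b / a) n * poch q q n * poch q a (N ∸ n) * a ^ n)
                       / ((1# - c * q ^ n) * poch q b n * poch q a N))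
      ≈ leftTerm N a b c n
    left-summand n 1≤n n≤N = begin
      qbinom q N n * ((poch q (b / a) n * poch q q n * poch q a (N ∸ n) * a ^ n)
                       * inv ((1# - c * q ^ n) * poch q b n * poch q a N))
        ≈⟨ *-cong (trans (qbinom-inside N n n≤N) (*-congˡ (inv-* (qqn≉0 n≤N) (qqN-n≉0 n))))
                  (*-congˡ (trans (inv-* (*-nonzero 1-cq^n≉0 bn≉0) aN≉0) (*-congʳ (inv-* 1-cq^n≉0 bn≉0)))) ⟩
      poch q q N * (inv (poch q q n) * inv (poch q q (N ∸ n)))
        * ((poch q (b / a) n * poch q q n * poch q a (N ∸ n) * a ^ n)
           * ((inv (1# - c * q ^ n) * inv (poch q b n)) * inv (poch q a N)))
        ≈⟨ solve 10 (λ QN iQn iQNn P Qn An an icn iBn iAN →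
             QN :* (iQn :* iQNn) :* ((P :* Qn :* An :* an) :* ((icn :* iBn) :* iAN))
             := (Qn :* iQn) :* (QN :* iQNn :* (P :* an) :* An :* icn :* iBn :* iAN)) refl
             (poch q q N) (inv (poch q q n)) (inv (poch q q (N ∸ n))) (poch q (b / a) n) (poch q q n)
             (poch q a (N ∸ n)) (a ^ n) (inv (1# - c * q ^ n)) (inv (poch q b n)) (inv (poch q a N)) ⟩
      (poch q q n * inv (poch q q n))
        * (poch q q N * inv (poch q q (N ∸ n)) * (poch q (b / a) n * a ^ n) * poch q a (N ∸ n)
           * inv (1# - c * q ^ n) * inv (poch q b n) * inv (poch q a N))
        ≈⟨ cancel-inverse (qqn≉0 n≤N) ⟩
      poch q q N * inv (poch q q (N ∸ n)) * (poch q (b / a) n * a ^ n) * poch q a (N ∸ n)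
        * inv (1# - c * q ^ n) * inv (poch q b n) * inv (poch q a N)
        ≈⟨ *-congʳ (*-congʳ (*-congʳ (*-congʳ (*-congˡ (poch-div≈hpoch b a≉0 n))))) ⟩
      leftTerm N a b c n ∎
      where
      1-cq^n≉0 : NonZero (1# - c * q ^ n)
      1-cq^n≉0 = 1-nonzero (c-avoids n 1≤n n≤N)
      bn≉0 : NonZero (poch q b n)
      bn≉0 = poch-nonzero n (avoids-≤ n≤N b-avoids)
      aN≉0 : NonZero (poch q a N)
      aN≉0 = poch-nonzero N a-avoids

    right-summand : ∀ n → 1 ≤ n → n ≤ N →
      qbinom q N n * ((poch q (b / c) (n ∸ 1) * poch q q n * poch q (c * q) (N ∸ n) * c ^ (n ∸ 1))
                       / (poch q b (n ∸ 1) * poch q (c * q) N)) * W n a b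
      ≈ rightTerm N a b c n
    right-summand n 1≤n n≤N = begin
      qbinom q N n * ((poch q (b / c) (n ∸ 1) * poch q q n * poch q (c * q) (N ∸ n) * c ^ (n ∸ 1))
                       * inv (poch q b (n ∸ 1) * poch q (c * q) N)) * W n a b
        ≈⟨ *-congʳ (*-cong (trans (qbinom-inside N n n≤N) (*-congˡ (inv-* (qqn≉0 n≤N) (qqN-n≉0 n))))
                           (*-congˡ (inv-* bn-1≉0 cqN≉0))) ⟩
      poch q q N * (inv (poch q q n) * inv (poch q q (N ∸ n)))
        * ((poch q (b / c) (n ∸ 1) * poch q q n * poch q (c * q) (N ∸ n) * c ^ (n ∸ 1))
           * (inv (poch q b (n ∸ 1)) * inv (poch q (c * q) N))) * W n a b
        ≈⟨ solve 10 (λ QN iQn iQNn P Qn CNn cn iBn iCN w →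
             QN :* (iQn :* iQNn) :* ((P :* Qn :* CNn :* cn) :* (iBn :* iCN)) :* w
             := (Qn :* iQn) :* (QN :* iQNn :* CNn :* iCN :* (P :* cn) :* iBn :* w)) refl
             (poch q q N) (inv (poch q q n)) (inv (poch q q (N ∸ n))) (poch q (b / c) (n ∸ 1)) (poch q q n)
             (poch q (c * q) (N ∸ n)) (c ^ (n ∸ 1)) (inv (poch q b (n ∸ 1))) (inv (poch q (c * q) N)) (W n a b) ⟩
      (poch q q n * inv (poch q q n))
        * (poch q q N * inv (poch q q (N ∸ n)) * poch q (c * q) (N ∸ n) * inv (poch q (c * q) N)
           * (poch q (b / c) (n ∸ 1) * c ^ (n ∸ 1)) * inv (poch q b (n ∸ 1)) * W n a b)
        ≈⟨ cancel-inverse (qqn≉0 n≤N) ⟩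
      poch q q N * inv (poch q q (N ∸ n)) * poch q (c * q) (N ∸ n) * inv (poch q (c * q) N)
        * (poch q (b / c) (n ∸ 1) * c ^ (n ∸ 1)) * inv (poch q b (n ∸ 1)) * W n a b
        ≈⟨ *-congʳ (*-congʳ (*-congˡ (poch-div≈hpoch b c≉0 (n ∸ 1)))) ⟩
      rightTerm N a b c n ∎
      where
      bn-1≉0 : NonZero (poch q b (n ∸ 1))
      bn-1≉0 = poch-nonzero (n ∸ 1) (avoids-≤ (ℕ.≤-trans (ℕ.m∸n≤m n 1) n≤N) b-avoids)
      cqN≉0 : NonZero (poch q (c * q) N)
      cqN≉0 = poch-nonzero N (avoids⁺⇒avoids-shift c-avoids)

theorem1p1 : ∀ {c ℓ : Level} (F : Field c ℓ) → let open Field F in let open FieldOps F in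
    (N : ℕ) (q a b c : Carrier) →
    ¬ (poch q q N ≈ 0#) →
    ¬ (a ≈ 0#) → ¬ (c ≈ 0#) →
    (∀ k → k < N → ¬ (a * q ^ k ≈ 1#)) →
    (∀ k → k < N → ¬ (b * q ^ k ≈ 1#)) →
    (∀ k → 1 ≤ k → k ≤ N → ¬ (c * q ^ k ≈ 1#)) →
    sum1 N (λ n → qbinom q N n
                  * ((poch q (b / a) n * poch q q n * poch q a (N ∸ n) * a ^ n)
                     / ((1# - c * q ^ n) * poch q b n * poch q a N)))
    ≈ sum1 N (λ n → qbinom q N n
                  * ((poch q (b / c) (n ∸ 1) * poch q q n * poch q (c * q) (N ∸ n) * c ^ (n ∸ 1))
                     / (poch q b (n ∸ 1) * poch q (c * q) N))
                  * ((a * q ^ (n ∸ 1)) / (1# - a * q ^ (n ∸ 1))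
                     - (b * q ^ (n ∸ 1)) / (1# - b * q ^ (n ∸ 1))))
theorem1p1 F N q a b c qq≉0 a≉0 c≉0 a-avoids b-avoids c-avoids = begin
  sum1 N _                   ≈⟨ sum1-cong N left-summand ⟩
  leftSum N a b c            ≈⟨ leftSum≈rightSum N H ⟩
  rightSum N a b c           ≈⟨ sum1-cong N right-summand ⟨
  sum1 N _                   ∎
  where
  open Field F
  open FieldOps F using (sum1)
  open QCalculus F q using (sum1-cong)
  open NormalisedSums F q
  open import Relation.Binary.Reasoning.Setoid setoid
  H : Admissible N a b c
  H = record { qq≉0 = qq≉0 ; a-avoids = a-avoids ; b-avoids = b-avoids ; c-avoids = c-avoids }
  open Summands N a b c a≉0 c≉0 H
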